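{- For a Boolean kit $(\mathbb{A},\mathcal{A})$, the following are equivalent: (1) the terminal presheaf on $\mathbb{A}$ belongs to $\mathrm{StPSh}(\mathbb{A},\mathcal{A})$; (2) for all objects $a\in\mathbb{A}$, $\mathcal{A}(a)$ is the set of all subgroups of $\mathrm{End}(a)$; (3) $\mathrm{StPSh}(\mathbb{A},\mathcal{A})=\mathrm{PSh}(\mathbb{A})$.
   Context: A kit on a groupoid $\mathbb{A}$ is a family $\mathcal{A}(a)$ of sets of subgroups of $\mathrm{End}(a)=\mathbb{A}(a,a)$ closed under conjugation. Subgroups $H,K$ of $\mathrm{End}(a)$ are orthogonal if $H\cap K=\{\mathrm{id}_a\}$; $\mathcal{A}^\perp(a)$ is the set of subgroups orthogonal to every member of $\mathcal{A}(a)$ (a kit on $\mathbb{A}^{op}$); the kit is Boolean if $\mathcal{A}=\mathcal{A}^{\perp\perp}$. $\mathrm{StPSh}(\mathbb{A},\mathcal{A})$ is the full subcategory of $\mathrm{PSh}(\mathbb{A})$ on presheaves $X$ such that for all $a$ and $x\in X(a)$, the stabilizer $\{\alpha\in\mathrm{End}(a):x\cdot\alpha=x\}$ belongs to $\mathcal{A}(a)$. -}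

module Defs where

open import Data.Unit using (⊤; tt)
open import Relation.Binary.PropositionalEquality
open import Function.Bundles using (_⇔_)

record Groupoid : Set₁ where
  infixr 9 _∘_
  field
    Obj  : Set
    Hom  : Obj → Obj → Set
    id   : ∀ {a} → Hom a a
    _∘_  : ∀ {a b c} → Hom b c → Hom a b → Hom a c
    _⁻¹  : ∀ {a b} → Hom a b → Hom b a
    idˡ  : ∀ {a b} (f : Hom a b) → id ∘ f ≡ f
    idʳ  : ∀ {a b} (f : Hom a b) → f ∘ id ≡ f
    assoc : ∀ {a b c d} (h : Hom c d) (g : Hom b c) (f : Hom a b) →
            (h ∘ g) ∘ f ≡ h ∘ (g ∘ f)
    invˡ : ∀ {a b} (f : Hom a b) → (f ⁻¹) ∘ f ≡ id
    invʳ : ∀ {a b} (f : Hom a b) → f ∘ (f ⁻¹) ≡ id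

  End : Obj → Set
  End a = Hom a a

module _ (𝔸 : Groupoid) where
  open Groupoid 𝔸

  record Subgroup (a : Obj) : Set₁ where
    field
      mem   : End a → Set
      id∈   : mem id
      ∘∈    : ∀ {f g} → mem f → mem g → mem (f ∘ g)
      ⁻¹∈   : ∀ {f} → mem f → mem (f ⁻¹)
  open Subgroup public

  IsConjugate : ∀ {a b} → Hom a b → Subgroup a → Subgroup b → Set
  IsConjugate f H K = ∀ g → mem K g ⇔ mem H ((f ⁻¹) ∘ g ∘ f)

  -- Taking f = id
  -- this also says 𝒜(a) respects equality (same elements) of subgroups.
  record Kit : Set₂ where
    field
      𝒜 : (a : Obj) → Subgroup a → Set₁
      conj-closed : ∀ {a b} (f : Hom a b) (H : Subgroup a) (K : Subgroup b) →
                    IsConjugate f H K → 𝒜 a H → 𝒜 b K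
  open Kit public

  Orthogonal : ∀ {a} → Subgroup a → Subgroup a → Set
  Orthogonal {a} H K = ∀ (f : End a) → mem H f → mem K f → f ≡ id

  Perp : ((a : Obj) → Subgroup a → Set₁) → (a : Obj) → Subgroup a → Set₁
  Perp 𝒜′ a H = ∀ (K : Subgroup a) → 𝒜′ a K → Orthogonal H K

  IsBoolean : Kit → Set₁
  IsBoolean 𝒦 = ∀ a (H : Subgroup a) → 𝒜 𝒦 a H ⇔ Perp (Perp (𝒜 𝒦)) a H

  record Presheaf : Set₁ where
    field
      F    : Obj → Set
      _·_  : ∀ {a b} → F a → Hom b a → F b
      ·id  : ∀ {a} (x : F a) → x · id ≡ x
      ·∘   : ∀ {a b c} (x : F a) (f : Hom b a) (g : Hom c b) →
             x · (f ∘ g) ≡ (x · f) · g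
  open Presheaf public

  stabilizer : (X : Presheaf) {a : Obj} → F X a → Subgroup a
  stabilizer X {a} x = record
    { mem = λ α → _·_ X x α ≡ x
    ; id∈ = ·id X x
    ; ∘∈  = λ {f} {g} p q →
        trans (·∘ X x f g) (trans (cong (λ y → _·_ X y g) p) q)
    ; ⁻¹∈ = λ {f} p →
        trans (cong (λ y → _·_ X y (f ⁻¹)) (sym p))
          (trans (sym (·∘ X x f (f ⁻¹)))
            (trans (cong (_·_ X x) (invʳ f)) (·id X x)))
    }

  InStPSh : Kit → Presheaf → Set₁
  InStPSh 𝒦 X = ∀ a (x : F X a) → 𝒜 𝒦 a (stabilizer X x)

  terminalPresheaf : Presheaf
  terminalPresheaf = record
    { F = λ _ → ⊤ ; _·_ = λ _ _ → tt ; ·id = λ _ → refl ; ·∘ = λ _ _ _ → refl }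

-- The stabilizer of the unique point of the terminal presheaf is all of
-- End(a).  Only the trivial subgroup is orthogonal to End(a), and every
-- subgroup is orthogonal to the trivial one; so once End(a) ∈ 𝒜(a), every
-- subgroup lies in 𝒜^⊥⊥(a) = 𝒜(a).
module Submission where

open import Defs
open import Function.Bundles using (_⇔_; mk⇔; Equivalence)
open import Data.Product using (_×_; _,_)
open import Data.Unit using (tt)
open import Relation.Binary.PropositionalEquality using (_≡_; refl)

module _ (𝔸 : Groupoid) where
  open Groupoid 𝔸

  IsFull : ∀ {a} → Subgroup 𝔸 a → Set
  IsFull H = ∀ f → mem H f

  IsTrivial : ∀ {a} → Subgroup 𝔸 a → Set
  IsTrivial {a} K = ∀ (f : End a) → mem K f → f ≡ id

  orthogonal-full⇒trivial : ∀ {a} {H K : Subgroup 𝔸 a} →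
    IsFull H → Orthogonal 𝔸 K H → IsTrivial K
  orthogonal-full⇒trivial full K⊥H f f∈K = K⊥H f f∈K (full f)

  orthogonal-trivial : ∀ {a} (H : Subgroup 𝔸 a) {K : Subgroup 𝔸 a} →
    IsTrivial K → Orthogonal 𝔸 H K
  orthogonal-trivial H trivial f _ f∈K = trivial f f∈K

  perp-perp-everything : (𝒜′ : (a : Obj) → Subgroup 𝔸 a → Set₁) {a : Obj}
    (G : Subgroup 𝔸 a) → IsFull G → 𝒜′ a G →
    ∀ (H : Subgroup 𝔸 a) → Perp 𝔸 (Perp 𝔸 𝒜′) a H
  perp-perp-everything 𝒜′ G full G∈𝒜′ H K K∈𝒜′⊥ =
    orthogonal-trivial H {K} (orthogonal-full⇒trivial {H = G} {K} full (K∈𝒜′⊥ G G∈𝒜′))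

  terminal-stabilizer-full : ∀ {a} → IsFull (stabilizer 𝔸 (terminalPresheaf 𝔸) {a} tt)
  terminal-stabilizer-full _ = refl

  boolean-full∈𝒜⇒all∈𝒜 : (𝒦 : Kit 𝔸) → IsBoolean 𝔸 𝒦 → ∀ {a}
    (G : Subgroup 𝔸 a) → IsFull G → 𝒜 𝒦 a G → ∀ (H : Subgroup 𝔸 a) → 𝒜 𝒦 a H
  boolean-full∈𝒜⇒all∈𝒜 𝒦 boolean {a} G full G∈𝒜 H =
    Equivalence.from (boolean a H) (perp-perp-everything (𝒜 𝒦) G full G∈𝒜 H)

proposition7p13 : (𝔸 : Groupoid) (𝒦 : Kit 𝔸) → IsBoolean 𝔸 𝒦 →
    ((InStPSh 𝔸 𝒦 (terminalPresheaf 𝔸)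
        ⇔ (∀ a (H : Subgroup 𝔸 a) → 𝒜 𝒦 a H))
    × ((∀ a (H : Subgroup 𝔸 a) → 𝒜 𝒦 a H)
        ⇔ (∀ (X : Presheaf 𝔸) → InStPSh 𝔸 𝒦 X)))
proposition7p13 𝔸 𝒦 boolean =
  mk⇔ terminal⇒all (λ all a _ → all a _) ,
  mk⇔ (λ all X a _ → all a _) (λ every → terminal⇒all (every (terminalPresheaf 𝔸)))
  where
  terminal⇒all : InStPSh 𝔸 𝒦 (terminalPresheaf 𝔸) → ∀ a (H : Subgroup 𝔸 a) → 𝒜 𝒦 a H
  terminal⇒all terminal∈ a =
    boolean-full∈𝒜⇒all∈𝒜 𝔸 𝒦 boolean _ (terminal-stabilizer-full 𝔸) (terminal∈ a tt)
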